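{- For $m\ge 3$ and $n\geq 2$, the chromatic polynomial of the signed graph $B_m^n$ is $\chi_{B_m^n}(\lambda)=(\lambda-1)^2\gamma_m^n$, where $\gamma_m=\frac{(\lambda-1)^{m-1}-(-1)^{m-1}}{\lambda}$.
   Context: The book graph $B(m,n)$ has vertices $\{u,v\}\cup\{u_j^i:1\le i\le n,1\le j\le m-2\}$ and consists of the $n$ cycles $uu_1^i\cdots u_{m-2}^ivu$ sharing the edge $uv$. The signed graph $B_m^n$ is obtained from $B(m,n)$ by replacing the edge $uv$ by two parallel edges between $u$ and $v$, one positive and one negative, all other edges being positive. For a signed graph with sign function $\sigma$, a proper coloring with colors $\{ -k,\ldots,0,\ldots,k\}$ is a map $c$ with $c(x)\ne\sigma(e)c(y)$ for each edge $e=xy$; the chromatic polynomial is the polynomial whose value at $\lambda=2k+1$ counts proper colorings. -}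

module Defs where

open import Data.Nat as ℕ using (ℕ; zero; suc)
open import Data.Integer as ℤ using (ℤ; +_; -_; _-_; _^_; _≤_)
open import Data.Integer.DivMod using (_/_)
open import Data.Fin using (Fin; zero; suc; combine; _↑ʳ_)
open import Data.List using (List; []; _∷_; concatMap; allFin)
open import Data.List.Relation.Unary.All using (All)
open import Data.Vec using (Vec; lookup)
open import Data.Product using (Σ; _×_; _,_; proj₁)
open import Relation.Nullary.Decidable using (False)
open import Function using (_∘_)

data Sign : Set where
  pos neg : Sign

act : Sign → ℤ → ℤ
act pos z = z
act neg z = - z

-- A signed (multi)graph on vertex set Fin V: a list of edges (x , y , σ(e)).
-- Parallel edges are allowed (the list may contain several edges between x, y).
record SignedGraph : Set where
  constructor mkSG
  field
    V     : ℕ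
    edges : List (Fin V × Fin V × Sign)
open SignedGraph public

Color : ℕ → Set
Color k = Σ ℤ (λ z → (- (+ k) ≤ z) × (z ≤ + k))

Coloring : SignedGraph → ℕ → Set
Coloring G k = Vec (Color k) (V G)

-- Proper: for each edge e = xy, c(x) ≠ σ(e) c(y)
-- (the inequality is expressed via the decision procedure, so that it is proof-irrelevant).
ProperEdge : ∀ {G k} → Coloring G k → Fin (V G) × Fin (V G) × Sign → Set
ProperEdge c (x , y , s) = False (proj₁ (lookup c x) ℤ.≟ act s (proj₁ (lookup c y)))

Proper : (G : SignedGraph) (k : ℕ) → Coloring G k → Set
Proper G k c = All (ProperEdge {G} {k} c) (edges G)

ProperColoring : SignedGraph → ℕ → Set
ProperColoring G k = Σ (Coloring G k) (Proper G k)

pathEdges : ∀ {V} (p : ℕ) → Fin V → Fin V → (Fin p → Fin V) → List (Fin V × Fin V × Sign)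
pathEdges zero    a b f = (a , b , pos) ∷ []
pathEdges (suc p) a b f = (a , f zero , pos) ∷ pathEdges p (f zero) b (f ∘ suc)

-- Vertices: u = 0, v = 1, u^i_j = 2 + combine i j  (i < n, j < m-2, 0-based).
Book : (m n : ℕ) → SignedGraph
Book m n = mkSG (2 ℕ.+ n ℕ.* (m ℕ.∸ 2))
  ((u , v , pos) ∷ (u , v , neg) ∷
   concatMap (λ i → pathEdges (m ℕ.∸ 2) u v (λ j → 2 ↑ʳ combine i j)) (allFin n))
  where
  u v : Fin (2 ℕ.+ n ℕ.* (m ℕ.∸ 2))
  u = zero
  v = suc zero

lam : ℕ → ℤ
lam k = + suc (2 ℕ.* k)

-- γ_m(λ) = ((λ-1)^{m-1} - (-1)^{m-1}) / λ   at λ = 2k+1 (an exact division).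
gamma : ℕ → ℕ → ℤ
gamma m k = ((lam k - + 1) ^ (m ℕ.∸ 1) - (- + 1) ^ (m ℕ.∸ 1)) / lam k

chiFormula : ℕ → ℕ → ℕ → ℤ
chiFormula m n k = (lam k - + 1) ^ 2 ℤ.* (gamma m k ^ n)

module Submission where

-- A proper coloring of B_m^n consists of colors a, b of u, v that are proper on the digon formed by
-- the positive and the negative edge uv, i.e. a ≠ ±b, together with, independently on each of the n
-- pages, a proper coloring of the inner vertices of the path u … v with the distinct end colors a, b.
-- Only 0 is its own negative, so there are (λ-1) + (λ-1)(λ-2) = (λ-1)² digon colorings.  The numbers
-- d_L and w_L of path colorings with L inner vertices and equal, resp. distinct, fixed end colors
-- satisfy d_{L+1} = (λ-1) w_L and w_{L+1} = d_L + (λ-2) w_L, whence λ w_L = (λ-1)^{L+1} - (-1)^{L+1}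
-- and w_{m-2} = γ_m.

open import Defs
open import Data.Nat as ℕ using (ℕ; zero; suc; _≤_; s≤s; z≤n; _∸_; NonZero)
open import Data.Nat.Properties as ℕ using ()
open import Data.Integer as ℤ using (+_; -[1+_]; -_; -≤+; +≤+)
open import Data.Integer.Properties as ℤ using ()
open import Data.Integer.Tactic.RingSolver using (solve-∀)
open import Data.Integer.DivMod using (div-pos-is-/ℕ)
open import Data.Nat.DivMod using (m*n/n≡m)
open import Data.Fin using (Fin; zero; suc; punchIn; punchOut; toℕ; fromℕ<; combine; _↑ʳ_)
open import Data.Fin.Properties
  using (punchInᵢ≢i; punchOut-punchIn; punchIn-punchOut; punchOut-cong; toℕ<n; fromℕ<-toℕ; toℕ-fromℕ<; *↔×; +↔⊎)
open import Data.Bool.Properties using (T-irrelevant)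
open import Data.List using (List)
open import Data.Product using (Σ; _×_; _,_; proj₁; proj₂)
open import Data.Product.Function.Dependent.Propositional using (Σ-↔)
open import Data.Product.Function.NonDependent.Propositional using (_×-↔_)
open import Data.Sum using (_⊎_; inj₁; inj₂)
open import Data.Sum.Function.Propositional using (_⊎-↔_)
open import Data.Vec using (Vec; []; _∷_; lookup; tabulate; concat; group)
open import Data.Vec.Relation.Unary.All using (All; []; _∷_) renaming (irrelevant to All-irrelevant)
open import Data.Vec.Relation.Unary.All.Properties using (lookup⁺; lookup⁻)
import Data.List.Relation.Unary.All as List
open import Data.List.Relation.Unary.All using ([]; _∷_)
import Data.List.Relation.Unary.All.Properties as List
open import Data.Vec.Properties using (++-injectiveˡ; ++-injectiveʳ; lookup-concat; tabulate-cong; tabulate∘lookup)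
open import Function using (_∘_)
open import Function.Bundles using (_↔_; _⇔_; mk↔ₛ′; mk⇔; Inverse; Equivalence)
open import Function.Properties.Inverse using (↔-refl; ↔-sym; ↔-trans)
open import Function.Related.TypeIsomorphisms using (Σ-assoc)
open import Relation.Binary.Definitions using (DecidableEquality)
open import Relation.Binary.PropositionalEquality
open import Relation.Nullary using (yes; no; contradiction)
open import Relation.Nullary.Decidable using (False; map′; toWitnessFalse; fromWitnessFalse)
import Relation.Nullary.Irrelevant as Nullary
open import Relation.Unary using (Irrelevant)

private variable
  A B : Set
  p q n : ℕ

Σ-≡-irrelevant : {P : A → Set} → Irrelevant P → {x y : A} {px : P x} {py : P y} → x ≡ y → (x , px) ≡ (y , py)
Σ-≡-irrelevant irr refl = cong (_ ,_) (irr _ _)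

×-irrelevant : {P Q : Set} → Nullary.Irrelevant P → Nullary.Irrelevant Q → Nullary.Irrelevant (P × Q)
×-irrelevant irrP irrQ (p₁ , q₁) (p₂ , q₂) = cong₂ _,_ (irrP p₁ p₂) (irrQ q₁ q₂)

irrelevant-⇔⇒↔ : {P Q : Set} → Nullary.Irrelevant P → Nullary.Irrelevant Q → P ⇔ Q → P ↔ Q
irrelevant-⇔⇒↔ irrP irrQ P⇔Q = mk↔ₛ′ to from (λ _ → irrQ _ _) (λ _ → irrP _ _)
  where open Equivalence P⇔Q

inhabited-×-↔ : {P : Set} → Nullary.Irrelevant P → P → (P × B) ↔ B
inhabited-×-↔ irr p = mk↔ₛ′ proj₂ (p ,_) (λ _ → refl) (λ (p′ , _) → cong (_, _) (irr p p′))

Σ↔Fin* : {P : A → Set} → A ↔ Fin p → (∀ x → P x ↔ Fin q) → Σ A P ↔ Fin (p ℕ.* q)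
Σ↔Fin* A↔Fin P↔Fin = ↔-trans (Σ-↔ ↔-refl (P↔Fin _)) (↔-trans (A↔Fin ×-↔ ↔-refl) (↔-sym *↔×))

⊎↔Fin+ : A ↔ Fin p → B ↔ Fin q → (A ⊎ B) ↔ Fin (p ℕ.+ q)
⊎↔Fin+ A↔Fin B↔Fin = ↔-trans (A↔Fin ⊎-↔ B↔Fin) (↔-sym +↔⊎)

All↔Fin^ : {P : A → Set} → Σ A P ↔ Fin p → ∀ n → Σ (Vec A n) (All P) ↔ Fin (p ℕ.^ n)
All↔Fin^ e zero = mk↔ₛ′ (λ _ → zero) (λ _ → [] , []) (λ { zero → refl }) (λ { ([] , []) → refl })
All↔Fin^ {A = A} {P = P} e (suc n) = ↔-trans uncons (↔-trans (e ×-↔ All↔Fin^ e n) (↔-sym *↔×))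
  where
  uncons : Σ (Vec A (suc n)) (All P) ↔ (Σ A P × Σ (Vec A n) (All P))
  uncons = mk↔ₛ′ (λ { (x ∷ xs , px ∷ pxs) → (x , px) , (xs , pxs) })
                 (λ ((x , px) , (xs , pxs)) → x ∷ xs , px ∷ pxs)
    (λ _ → refl) (λ { (_ ∷ _ , _ ∷ _) → refl })

-- R stands in for x ≢ a, which is not provably proof-irrelevant without function extensionality.
complement↔Fin : {R : A → Set} → A ↔ Fin n → (a : A) → Irrelevant R → (∀ {x} → R x ⇔ (x ≢ a)) →
                 Σ A R ↔ Fin (n ∸ 1)
complement↔Fin {n = zero} e a _ _ with () ← Inverse.to e a
complement↔Fin {A = A} {n = suc n} {R = R} e a irr R⇔≢ = mk↔ₛ′ to from to∘from from∘to
  where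
  open Inverse e renaming (to to idx; from to elt)
  i≢idx : ∀ {x} → R x → idx a ≢ idx x
  i≢idx {x} rx eq = Equivalence.to R⇔≢ rx
    (trans (sym (strictlyInverseʳ x)) (trans (cong elt (sym eq)) (strictlyInverseʳ a)))
  to : Σ A R → Fin n
  to (x , rx) = punchOut (i≢idx rx)
  from : Fin n → Σ A R
  from j = elt (punchIn (idx a) j) ,
    Equivalence.from R⇔≢ (λ eq → punchInᵢ≢i (idx a) j (trans (sym (strictlyInverseˡ _)) (cong idx eq)))
  to∘from : ∀ j → to (from j) ≡ j
  to∘from j = trans (punchOut-cong (idx a) (strictlyInverseˡ _)) (punchOut-punchIn (idx a))
  from∘to : ∀ y → from (to y) ≡ y
  from∘to (x , rx) = Σ-≡-irrelevant irr (trans (cong elt (punchIn-punchOut (i≢idx rx))) (strictlyInverseʳ x))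

concat-injective : ∀ {l} (xss yss : Vec (Vec A l) n) → concat xss ≡ concat yss → xss ≡ yss
concat-injective [] [] _ = refl
concat-injective (xs ∷ xss) (ys ∷ yss) eq =
  cong₂ _∷_ (++-injectiveˡ xs ys eq) (concat-injective xss yss (++-injectiveʳ xs ys eq))

-- d_L and w_L for q + 1 = λ colors.
pathsSameEnds pathsDistinctEnds : ℕ → ℕ → ℕ
pathsSameEnds q zero = 0
pathsSameEnds q (suc L) = q ℕ.* pathsDistinctEnds q L
pathsDistinctEnds q zero = 1
pathsDistinctEnds q (suc L) = pathsSameEnds q L ℕ.+ (q ∸ 1) ℕ.* pathsDistinctEnds q L

m+m*[m∸1]≡m^2 : ∀ m → m ℕ.+ m ℕ.* (m ∸ 1) ≡ m ℕ.^ 2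
m+m*[m∸1]≡m^2 zero = refl
m+m*[m∸1]≡m^2 (suc m) = begin
  suc m ℕ.+ suc m ℕ.* m      ≡⟨ ℕ.*-suc (suc m) m ⟨
  suc m ℕ.* suc m            ≡⟨ cong (suc m ℕ.*_) (ℕ.*-identityʳ (suc m)) ⟨
  suc m ℕ.^ 2                ∎
  where open ≡-Reasoning

module ColorSet {A : Set} (_≟_ : DecidableEquality A) where

  _≉_ : A → A → Set
  x ≉ y = False (x ≟ y)

  ≉-irrelevant : ∀ {x y} → Nullary.Irrelevant (x ≉ y)
  ≉-irrelevant = T-irrelevant

  ≉⇒≢ : ∀ {x y} → x ≉ y → x ≢ y
  ≉⇒≢ = toWitnessFalse

  ≢⇒≉ : ∀ {x y} → x ≢ y → x ≉ y
  ≢⇒≉ = fromWitnessFalse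

  ≉-sym : ∀ {x y} → x ≉ y → y ≉ x
  ≉-sym x≉y = ≢⇒≉ (≉⇒≢ x≉y ∘ sym)

  ≉↔Fin : A ↔ Fin (suc q) → (a : A) → Σ A (a ≉_) ↔ Fin q
  ≉↔Fin e a = complement↔Fin e a ≉-irrelevant
    (mk⇔ (λ a≉x → ≉⇒≢ a≉x ∘ sym) (λ x≢a → ≢⇒≉ (x≢a ∘ sym)))

  Σ-split-at : {P : A → Set} (b : A) → Σ A P ↔ (P b ⊎ Σ (Σ A (b ≉_)) (P ∘ proj₁))
  Σ-split-at {P = P} b = mk↔ₛ′ to from to∘from from∘to
    where
    to : Σ A P → P b ⊎ Σ (Σ A (b ≉_)) (P ∘ proj₁)
    to (x , px) with x ≟ b
    ... | yes refl = inj₁ px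
    ... | no x≢b = inj₂ ((x , ≢⇒≉ (x≢b ∘ sym)) , px)
    from : P b ⊎ Σ (Σ A (b ≉_)) (P ∘ proj₁) → Σ A P
    from (inj₁ pb) = b , pb
    from (inj₂ ((x , _) , px)) = x , px
    to∘from : ∀ y → to (from y) ≡ y
    to∘from (inj₁ pb) with b ≟ b
    ... | yes refl = refl
    ... | no b≢b = contradiction refl b≢b
    to∘from (inj₂ ((x , b≉x) , px)) with x ≟ b
    ... | yes refl = contradiction refl (≉⇒≢ b≉x)
    ... | no _ = cong (λ b≉x′ → inj₂ ((x , b≉x′) , px)) (≉-irrelevant _ _)
    from∘to : ∀ x → from (to x) ≡ x
    from∘to (x , px) with x ≟ b
    ... | yes refl = refl
    ... | no _ = refl

  ProperPath : ∀ {L} → A → A → Vec A L → Set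
  ProperPath a b [] = a ≉ b
  ProperPath a b (x ∷ xs) = a ≉ x × ProperPath x b xs

  ProperPath-irrelevant : ∀ {L a b} (xs : Vec A L) → Nullary.Irrelevant (ProperPath a b xs)
  ProperPath-irrelevant [] = ≉-irrelevant
  ProperPath-irrelevant (_ ∷ xs) = ×-irrelevant ≉-irrelevant (ProperPath-irrelevant xs)

  Paths : ℕ → A → A → Set
  Paths L a b = Σ (Vec A L) (ProperPath a b)

  Paths-suc↔ : ∀ {L a b} → Paths (suc L) a b ↔ Σ A (λ x → a ≉ x × Paths L x b)
  Paths-suc↔ = mk↔ₛ′ (λ { (x ∷ xs , a≉x , pxs) → x , a≉x , xs , pxs })
                     (λ (x , a≉x , xs , pxs) → x ∷ xs , a≉x , pxs)
    (λ _ → refl) (λ { (_ ∷ _ , _) → refl })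

  module _ (A↔Fin : A ↔ Fin (suc q)) where

    Paths-same↔Fin : ∀ L a → Paths L a a ↔ Fin (pathsSameEnds q L)
    Paths-distinct↔Fin : ∀ L {a b} → a ≉ b → Paths L a b ↔ Fin (pathsDistinctEnds q L)

    Paths-same↔Fin zero a =
      mk↔ₛ′ (λ { ([] , a≉a) → contradiction refl (≉⇒≢ a≉a) }) (λ ()) (λ ())
            (λ { ([] , a≉a) → contradiction refl (≉⇒≢ a≉a) })
    Paths-same↔Fin (suc L) a = ↔-trans Paths-suc↔ (↔-trans (↔-sym Σ-assoc)
      (Σ↔Fin* (≉↔Fin A↔Fin a) (λ (x , a≉x) → Paths-distinct↔Fin L (≉-sym a≉x))))

    Paths-distinct↔Fin zero a≉b =
      mk↔ₛ′ (λ _ → zero) (λ _ → [] , a≉b) (λ { zero → refl })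
            (λ { ([] , a≉b′) → cong ([] ,_) (≉-irrelevant a≉b a≉b′) })
    Paths-distinct↔Fin (suc L) {a} {b} a≉b = ↔-trans Paths-suc↔ (↔-trans (Σ-split-at b)
      (⊎↔Fin+ (↔-trans (inhabited-×-↔ ≉-irrelevant a≉b) (Paths-same↔Fin L b))
              (↔-trans (↔-sym Σ-assoc)
                (Σ↔Fin* other↔Fin (λ ((x , b≉x) , _) → Paths-distinct↔Fin L (≉-sym b≉x))))))
      where
      other↔Fin : Σ (Σ A (b ≉_)) (λ (x , _) → a ≉ x) ↔ Fin (q ∸ 1)
      other↔Fin = complement↔Fin (≉↔Fin A↔Fin b) (a , ≉-sym a≉b) ≉-irrelevant
        (mk⇔ (λ a≉x x≡a → ≉⇒≢ a≉x (sym (cong proj₁ x≡a)))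
             (λ x≢a → ≢⇒≉ (λ a≡x → x≢a (Σ-≡-irrelevant ≉-irrelevant (sym a≡x)))))

  module Signed (ι : A → A) where

    -- Properness across the positive and the negative edge of a digon, ι being the negation of colors.
    _≉±_ : A → A → Set
    a ≉± b = a ≉ b × a ≉ ι b

    DigonColoring : Set
    DigonColoring = Σ A (λ a → Σ A (a ≉±_))

    module _ (ι-involutive : ∀ x → ι (ι x) ≡ x)
             (o : A) (ι-o : ι o ≡ o) (ι-fixed⇒o : ∀ {x} → ι x ≡ x → x ≡ o) where

      DigonColoring↔Fin : A ↔ Fin (suc q) → DigonColoring ↔ Fin (q ℕ.^ 2)
      DigonColoring↔Fin {q} A↔Fin = subst (λ N → DigonColoring ↔ Fin N) (m+m*[m∸1]≡m^2 q)
        (↔-trans (Σ-split-at o) (⊎↔Fin+ fixed↔Fin (Σ↔Fin* (≉↔Fin A↔Fin o) moved↔Fin)))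
        where
        fixed↔Fin : Σ A (o ≉±_) ↔ Fin q
        fixed↔Fin = complement↔Fin A↔Fin o (×-irrelevant ≉-irrelevant ≉-irrelevant)
          (λ {b} → mk⇔ (λ (o≉b , _) b≡o → ≉⇒≢ o≉b (sym b≡o))
               (λ b≢o → ≢⇒≉ (b≢o ∘ sym) , ≢⇒≉ (λ o≡ιb → b≢o (begin
                 b ≡⟨ ι-involutive b ⟨
                 ι (ι b) ≡⟨ cong ι o≡ιb ⟨
                 ι o ≡⟨ ι-o ⟩
                 o ∎))))
          where open ≡-Reasoning
        moved↔Fin : ((a , _) : Σ A (o ≉_)) → Σ A (a ≉±_) ↔ Fin (q ∸ 1)
        moved↔Fin (a , o≉a) = ↔-trans (↔-sym Σ-assoc)
          (complement↔Fin (≉↔Fin A↔Fin a) (ι a , a≉ιa) ≉-irrelevant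
          (mk⇔ (λ a≉ιb b≡ιa → ≉⇒≢ a≉ιb (trans (sym (ι-involutive a)) (cong (ι ∘ proj₁) (sym b≡ιa))))
               (λ b≢ιa → ≢⇒≉ (λ a≡ιb →
                  b≢ιa (Σ-≡-irrelevant ≉-irrelevant (trans (sym (ι-involutive _)) (cong ι (sym a≡ιb))))))))
          where
          a≉ιa : a ≉ ι a
          a≉ιa = ≢⇒≉ (λ a≡ιa → ≉⇒≢ o≉a (sym (ι-fixed⇒o (sym a≡ιa))))

module _ {k : ℕ} where

  Color-≡ : {x y : Color k} → proj₁ x ≡ proj₁ y → x ≡ y
  Color-≡ {z , _} {.z , _} refl = cong (z ,_) (cong₂ _,_ (ℤ.≤-irrelevant _ _) (ℤ.≤-irrelevant _ _))

  _≟ᶜ_ : DecidableEquality (Color k)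
  x ≟ᶜ y = map′ Color-≡ (cong proj₁) (proj₁ x ℤ.≟ proj₁ y)

  -ᶜ_ : Color k → Color k
  -ᶜ (z , lo , hi) = - z , ℤ.neg-mono-≤ hi , subst (- z ℤ.≤_) (ℤ.neg-involutive (+ k)) (ℤ.neg-mono-≤ lo)

  0ᶜ : Color k
  0ᶜ = + 0 , ℤ.neg-≤-pos , +≤+ z≤n

  -ᶜ-involutive : ∀ x → -ᶜ (-ᶜ x) ≡ x
  -ᶜ-involutive x = Color-≡ (ℤ.neg-involutive (proj₁ x))

  -ᶜ-fixed⇒0ᶜ : ∀ {x} → -ᶜ x ≡ x → x ≡ 0ᶜ
  -ᶜ-fixed⇒0ᶜ {x} -x≡x = Color-≡ (self-negative (proj₁ x) (cong proj₁ -x≡x))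
    where
    self-negative : ∀ z → - z ≡ z → z ≡ + 0
    self-negative (+ zero) _ = refl

  Color↔Fin : Color k ↔ Fin (suc (2 ℕ.* k))
  Color↔Fin = subst (λ N → Color k ↔ Fin N) (cong (λ j → suc (k ℕ.+ j)) (sym (ℕ.+-identityʳ k)))
    (↔-trans Color↔⊎ (↔-sym +↔⊎))
    where
    Color↔⊎ : Color k ↔ (Fin (suc k) ⊎ Fin k)
    Color↔⊎ = mk↔ₛ′ to from to∘from from∘to
      where
      to : Color k → Fin (suc k) ⊎ Fin k
      to (+ i , _ , +≤+ i≤k) = inj₁ (fromℕ< (s≤s i≤k))
      to (-[1+ i ] , lo , _) = inj₂ (fromℕ< (ℤ.drop‿+≤+ (ℤ.neg-cancel-≤ {j = + suc i} lo)))
      from : Fin (suc k) ⊎ Fin k → Color k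
      from (inj₁ i) = + toℕ i , ℤ.neg-≤-pos , +≤+ (ℕ.≤-pred (toℕ<n i))
      from (inj₂ i) = -[1+ toℕ i ] , ℤ.neg-mono-≤ (+≤+ (toℕ<n i)) , -≤+
      to∘from : ∀ y → to (from y) ≡ y
      to∘from (inj₁ i) = cong inj₁ (fromℕ<-toℕ i _)
      to∘from (inj₂ i) = cong inj₂ (fromℕ<-toℕ i _)
      from∘to : ∀ x → from (to x) ≡ x
      from∘to (+ _ , _ , +≤+ _) = Color-≡ (cong +_ (toℕ-fromℕ< _))
      from∘to (-[1+ _ ] , _ , _) = Color-≡ (cong -[1+_] (toℕ-fromℕ< _))

module _ {k : ℕ} where
  open ColorSet (_≟ᶜ_ {k})
  open Signed -ᶜ_

  ≉ᶻ⇒≉ : {x y : Color k} → False (proj₁ x ℤ.≟ proj₁ y) → x ≉ y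
  ≉ᶻ⇒≉ x≉y = ≢⇒≉ (toWitnessFalse x≉y ∘ cong proj₁)

  ≉⇒≉ᶻ : {x y : Color k} → x ≉ y → False (proj₁ x ℤ.≟ proj₁ y)
  ≉⇒≉ᶻ x≉y = fromWitnessFalse (≉⇒≢ x≉y ∘ Color-≡)

  ColorDigon↔Fin : DigonColoring ↔ Fin ((2 ℕ.* k) ℕ.^ 2)
  ColorDigon↔Fin = DigonColoring↔Fin -ᶜ-involutive 0ᶜ (Color-≡ refl) -ᶜ-fixed⇒0ᶜ Color↔Fin

  ProperPath⇔pathEdges : ∀ G (c : Coloring G k) p x y (f : Fin p → Fin (V G)) →
    List.All (ProperEdge {G} {k} c) (pathEdges p x y f) ⇔ ProperPath (lookup c x) (lookup c y) (tabulate (lookup c ∘ f))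
  ProperPath⇔pathEdges G c zero x y f = mk⇔ (λ { (e ∷ []) → ≉ᶻ⇒≉ e }) (λ e → ≉⇒≉ᶻ e ∷ [])
  ProperPath⇔pathEdges G c (suc p) x y f =
    mk⇔ (λ { (e ∷ es) → ≉ᶻ⇒≉ e , to es }) (λ (e , es) → ≉⇒≉ᶻ e ∷ from es)
    where open Equivalence (ProperPath⇔pathEdges G c p (f zero) y (f ∘ suc))

  module _ (m n : ℕ) where

    Interiors : Set
    Interiors = Vec (Vec (Color k) (m ∸ 2)) n

    assemble↔ : (Color k × Color k × Interiors) ↔ Coloring (Book m n) k
    assemble↔ = mk↔ₛ′ (λ (a , b , rows) → a ∷ b ∷ concat rows) (λ { (a ∷ b ∷ rest) → a , b , ungroup rest })
      (λ { (a ∷ b ∷ rest) → cong (λ v → a ∷ b ∷ v) (sym (proj₂ (group n (m ∸ 2) rest))) })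
      (λ (a , b , rows) → cong (λ rs → a , b , rs)
        (concat-injective _ rows (sym (proj₂ (group n (m ∸ 2) (concat rows))))))
      where
      ungroup : Vec (Color k) (n ℕ.* (m ∸ 2)) → Interiors
      ungroup rest = proj₁ (group n (m ∸ 2) rest)

    Page : Fin n → List (Fin (V (Book m n)) × Fin (V (Book m n)) × Sign)
    Page i = pathEdges (m ∸ 2) zero (suc zero) (λ j → 2 ↑ʳ combine i j)

    ProperPath⇔Page : ∀ {a b} (rows : Interiors) i →
      List.All (ProperEdge {Book m n} {k} (a ∷ b ∷ concat rows)) (Page i) ⇔ ProperPath a b (lookup rows i)
    ProperPath⇔Page {a} {b} rows i =
      subst (λ row → List.All (ProperEdge {Book m n} {k} c) (Page i) ⇔ ProperPath a b row) row≡
        (ProperPath⇔pathEdges (Book m n) c (m ∸ 2) zero (suc zero) (λ j → 2 ↑ʳ combine i j))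
      where
      c = a ∷ b ∷ concat rows
      row≡ : tabulate (λ j → lookup (concat rows) (combine i j)) ≡ lookup rows i
      row≡ = trans (tabulate-cong (lookup-concat rows i)) (tabulate∘lookup (lookup rows i))

    Proper-assemble⇔ : ∀ {a b} {rows : Interiors} →
      Proper (Book m n) k (a ∷ b ∷ concat rows) ⇔ (a ≉± b × All (ProperPath a b) rows)
    Proper-assemble⇔ {rows = rows} = mk⇔
      (λ { (a≉b ∷ a≉-b ∷ pages) → (≉ᶻ⇒≉ a≉b , ≉ᶻ⇒≉ a≉-b) ,
             lookup⁻ (λ i → Equivalence.to (ProperPath⇔Page rows i)
                              (List.tabulate⁻ (List.map⁻ (List.concat⁻ pages)) i)) })
      (λ ((a≉b , a≉-b) , paths) → ≉⇒≉ᶻ a≉b ∷ ≉⇒≉ᶻ a≉-b ∷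
             List.concat⁺ (List.map⁺ (List.tabulate⁺ (λ i →
               Equivalence.from (ProperPath⇔Page rows i) (lookup⁺ paths i)))))

    ProperColoring-Book↔ :
      ProperColoring (Book m n) k ↔ Σ DigonColoring (λ (a , b , _) → Σ Interiors (All (ProperPath a b)))
    ProperColoring-Book↔ = ↔-trans (↔-sym (Σ-↔ assemble↔ ↔-refl)) (↔-trans (Σ-↔ ↔-refl proper↔) regroup)
      where
      proper↔ : ∀ {(a , b , rows) : Color k × Color k × Interiors} →
        Proper (Book m n) k (a ∷ b ∷ concat rows) ↔ (a ≉± b × All (ProperPath a b) rows)
      proper↔ = irrelevant-⇔⇒↔ (List.irrelevant T-irrelevant)
        (×-irrelevant (×-irrelevant ≉-irrelevant ≉-irrelevant) (All-irrelevant (λ {xs} → ProperPath-irrelevant xs)))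
        Proper-assemble⇔
      regroup : Σ (Color k × Color k × Interiors) (λ (a , b , rows) → a ≉± b × All (ProperPath a b) rows)
              ↔ Σ DigonColoring (λ (a , b , _) → Σ Interiors (All (ProperPath a b)))
      regroup = mk↔ₛ′ (λ ((a , b , rows) , ab , ps) → (a , b , ab) , rows , ps)
                      (λ ((a , b , ab) , rows , ps) → (a , b , rows) , ab , ps) (λ _ → refl) (λ _ → refl)

    ProperColoring-Book↔Fin :
      ProperColoring (Book m n) k ↔ Fin ((2 ℕ.* k) ℕ.^ 2 ℕ.* pathsDistinctEnds (2 ℕ.* k) (m ∸ 2) ℕ.^ n)
    ProperColoring-Book↔Fin = ↔-trans ProperColoring-Book↔
      (Σ↔Fin* ColorDigon↔Fin (λ (_ , _ , a≉b , _) → All↔Fin^ (Paths-distinct↔Fin Color↔Fin (m ∸ 2) a≉b) n))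

-- q ≠ 0 because of the truncated subtraction q ∸ 1 in pathsDistinctEnds.
λ*pathsSameEnds : ∀ q .{{_ : NonZero q}} L →
  (+ suc q) ℤ.* (+ pathsSameEnds q L) ≡ (+ q) ℤ.^ suc L ℤ.+ (+ q) ℤ.* (- + 1) ℤ.^ suc L
λ*pathsDistinctEnds : ∀ q .{{_ : NonZero q}} L →
  (+ suc q) ℤ.* (+ pathsDistinctEnds q L) ≡ (+ q) ℤ.^ suc L ℤ.- (- + 1) ℤ.^ suc L

λ*pathsSameEnds q zero = base (+ q)
  where
  base : ∀ Q → (+ 1 ℤ.+ Q) ℤ.* + 0 ≡ Q ℤ.* + 1 ℤ.+ Q ℤ.* (- + 1 ℤ.* + 1)
  base = solve-∀
λ*pathsSameEnds q (suc L) = begin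
  Λ ℤ.* + (q ℕ.* w)          ≡⟨ cong (Λ ℤ.*_) (ℤ.pos-* q w) ⟩
  Λ ℤ.* (Q ℤ.* W)            ≡⟨ swap Λ Q W ⟩
  Q ℤ.* (Λ ℤ.* W)            ≡⟨ cong (Q ℤ.*_) (λ*pathsDistinctEnds q L) ⟩
  Q ℤ.* (P ℤ.- s)            ≡⟨ expand Q P s ⟩
  Q ℤ.* P ℤ.+ Q ℤ.* (- + 1 ℤ.* s) ∎
  where
  open ≡-Reasoning
  Λ = + suc q
  Q = + q
  w = pathsDistinctEnds q L
  W = + w
  P = Q ℤ.^ suc L
  s = (- + 1) ℤ.^ suc L
  swap : ∀ x y z → x ℤ.* (y ℤ.* z) ≡ y ℤ.* (x ℤ.* z)
  swap = solve-∀
  expand : ∀ x y z → x ℤ.* (y ℤ.- z) ≡ x ℤ.* y ℤ.+ x ℤ.* (- + 1 ℤ.* z)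
  expand = solve-∀

λ*pathsDistinctEnds q zero = base (+ q)
  where
  base : ∀ Q → (+ 1 ℤ.+ Q) ℤ.* + 1 ≡ Q ℤ.* + 1 ℤ.- (- + 1 ℤ.* + 1)
  base = solve-∀
λ*pathsDistinctEnds (suc p) (suc L) = begin
  Λ ℤ.* + (d ℕ.+ p ℕ.* w)
    ≡⟨ cong (Λ ℤ.*_) (trans (ℤ.pos-+ d (p ℕ.* w)) (cong (λ x → D ℤ.+ x) (ℤ.pos-* p w))) ⟩
  Λ ℤ.* (D ℤ.+ (Q ℤ.- + 1) ℤ.* W)
    ≡⟨ distrib Λ D (Q ℤ.- + 1) W ⟩
  Λ ℤ.* D ℤ.+ (Q ℤ.- + 1) ℤ.* (Λ ℤ.* W)
    ≡⟨ cong₂ (λ x y → x ℤ.+ (Q ℤ.- + 1) ℤ.* y) (λ*pathsSameEnds (suc p) L) (λ*pathsDistinctEnds (suc p) L) ⟩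
  (P ℤ.+ Q ℤ.* s) ℤ.+ (Q ℤ.- + 1) ℤ.* (P ℤ.- s)
    ≡⟨ collect Q P s ⟩
  Q ℤ.* P ℤ.- (- + 1 ℤ.* s)
    ∎
  where
  open ≡-Reasoning
  Λ = + suc (suc p)
  Q = + suc p
  d = pathsSameEnds (suc p) L
  w = pathsDistinctEnds (suc p) L
  D = + d
  W = + w
  P = Q ℤ.^ suc L
  s = (- + 1) ℤ.^ suc L
  distrib : ∀ x y z u → x ℤ.* (y ℤ.+ z ℤ.* u) ≡ x ℤ.* y ℤ.+ z ℤ.* (x ℤ.* u)
  distrib = solve-∀
  collect : ∀ x y z → (y ℤ.+ x ℤ.* z) ℤ.+ (x ℤ.- + 1) ℤ.* (y ℤ.- z) ≡ x ℤ.* y ℤ.- (- + 1 ℤ.* z)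
  collect = solve-∀

n*m/n≡m : ∀ m n .{{_ : NonZero n}} → ((+ n) ℤ.* (+ m)) ℤ./ (+ n) ≡ + m
n*m/n≡m m n = begin
  ((+ n) ℤ.* (+ m)) ℤ./ (+ n)  ≡⟨ cong (ℤ._/ + n) (ℤ.pos-* n m) ⟨
  (+ (n ℕ.* m)) ℤ./ (+ n)      ≡⟨ div-pos-is-/ℕ (+ (n ℕ.* m)) n ⟩
  + (n ℕ.* m ℕ./ n)            ≡⟨ cong +_ (trans (cong (ℕ._/ n) (ℕ.*-comm n m)) (m*n/n≡m m n)) ⟩
  + m                          ∎
  where open ≡-Reasoning

gamma≡pathsDistinctEnds : ∀ k .{{_ : NonZero k}} L → gamma (2 ℕ.+ L) k ≡ + pathsDistinctEnds (2 ℕ.* k) L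
gamma≡pathsDistinctEnds (suc k) L = begin
  ((+ 2k) ℤ.^ suc L ℤ.- (- + 1) ℤ.^ suc L) ℤ./ lam (suc k)  ≡⟨ cong (ℤ._/ lam (suc k)) (λ*pathsDistinctEnds 2k L) ⟨
  (lam (suc k) ℤ.* (+ w)) ℤ./ lam (suc k)                   ≡⟨ n*m/n≡m w (suc 2k) ⟩
  + w                                                       ∎
  where
  open ≡-Reasoning
  2k = 2 ℕ.* suc k
  w = pathsDistinctEnds 2k L

pos-^ : ∀ m n → + (m ℕ.^ n) ≡ (+ m) ℤ.^ n
pos-^ m zero = refl
pos-^ m (suc n) = trans (ℤ.pos-* m (m ℕ.^ n)) (cong ((+ m) ℤ.*_) (pos-^ m n))

count≡chiFormula : ∀ L n k →
  + ((2 ℕ.* k) ℕ.^ 2 ℕ.* pathsDistinctEnds (2 ℕ.* k) L ℕ.^ n) ≡ chiFormula (2 ℕ.+ L) n k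
-- For k = 0 both sides vanish, although γ_m ≠ w_{m-2} at λ = 1.
count≡chiFormula L n zero = refl
count≡chiFormula L n k@(suc _) = begin
  + (2k ℕ.^ 2 ℕ.* w ℕ.^ n)             ≡⟨ ℤ.pos-* (2k ℕ.^ 2) (w ℕ.^ n) ⟩
  + (2k ℕ.^ 2) ℤ.* + (w ℕ.^ n)         ≡⟨ cong₂ ℤ._*_ (pos-^ 2k 2) (pos-^ w n) ⟩
  (+ 2k) ℤ.^ 2 ℤ.* (+ w) ℤ.^ n         ≡⟨ cong (λ γ → (+ 2k) ℤ.^ 2 ℤ.* γ ℤ.^ n) (gamma≡pathsDistinctEnds k L) ⟨
  chiFormula (2 ℕ.+ L) n k             ∎
  where
  open ≡-Reasoning
  2k = 2 ℕ.* k
  w = pathsDistinctEnds 2k L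

proposition3p5 : (m n : ℕ) → 3 ≤ m → 2 ≤ n → (k : ℕ) →
    Σ ℕ (λ N → (ProperColoring (Book m n) k ↔ Fin N) × (+ N ≡ chiFormula m n k))
proposition3p5 m@(suc (suc L)) n (s≤s (s≤s _)) _ k = _ , ProperColoring-Book↔Fin m n , count≡chiFormula L n k
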